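{- If $G$ is a $3$-free digraph then $\beta(G)\le \gamma(G)$.
   Context: All digraphs are finite, with no loops and no parallel edges; edges are ordered pairs $uv$ of distinct vertices. A digraph is $3$-free if it has no directed cycle of length at most $3$ (in particular, no two vertices $u,v$ with both $uv$ and $vu$ edges). A digraph is acyclic if it has no directed cycle. For a digraph $G$, $\beta(G)$ is the minimum cardinality of a set $X\subseteq E(G)$ such that $G\setminus X$ is acyclic, and $\gamma(G)$ is the number of unordered pairs $\{u,v\}$ of distinct vertices such that $uv\notin E(G)$ and $vu\notin E(G)$. -}

module Defs where

open import Data.Nat using (ℕ; zero; suc; _<ᵇ_; _≤_)
open import Data.Bool using (Bool; true; false; not; _∧_; if_then_else_)
open import Data.Fin using (Fin; zero; suc; toℕ; inject₁; fromℕ)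
open import Data.List using (List; map; allFin)
open import Data.Nat.ListAction using (sum)
open import Data.Product using (Σ; _×_)
open import Relation.Binary.PropositionalEquality using (_≡_)
open import Relation.Nullary using (¬_)
open import Function.Definitions using (Injective)

-- A digraph on the vertex set Fin n: a Boolean adjacency relation with no loops.
-- (Parallel edges are impossible in this representation; uv and vu are distinct
-- ordered pairs.)
record Digraph (n : ℕ) : Set where
  field
    adj      : Fin n → Fin n → Bool
    loopless : ∀ v → adj v v ≡ false
open Digraph public

PairSet : ℕ → Set
PairSet n = Fin n → Fin n → Bool

card : ∀ {n} → PairSet n → ℕ
card {n} S = sum (map (λ u → sum (map (λ v → if S u v then 1 else 0) (allFin n))) (allFin n))

-- A directed cycle of length (suc m) in a relation R: distinct vertices
-- c 0, …, c m with edges c i → c (i+1) and c m → c 0.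
record DirCycle {n : ℕ} (R : PairSet n) (m : ℕ) : Set where
  field
    vert   : Fin (suc m) → Fin n
    inj    : Injective _≡_ _≡_ vert
    step   : ∀ (i : Fin m) → R (vert (inject₁ i)) (vert (suc i)) ≡ true
    close  : R (vert (fromℕ m)) (vert zero) ≡ true

ThreeFree : ∀ {n} → Digraph n → Set
ThreeFree G = ∀ m → suc m ≤ 3 → ¬ DirCycle (adj G) m

AcyclicRel : ∀ {n} → PairSet n → Set
AcyclicRel R = ∀ m → ¬ DirCycle R m

SubsetOfEdges : ∀ {n} → PairSet n → Digraph n → Set
SubsetOfEdges X G = ∀ u v → X u v ≡ true → adj G u v ≡ true

deleteEdges : ∀ {n} → Digraph n → PairSet n → PairSet n
deleteEdges G X u v = adj G u v ∧ not (X u v)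

IsFeedbackArcSet : ∀ {n} → Digraph n → PairSet n → Set
IsFeedbackArcSet G X = SubsetOfEdges X G × AcyclicRel (deleteEdges G X)

-- β(G) ≤ k : some feedback arc set has cardinality at most k
-- (β(G) is the minimum such cardinality).
BetaAtMost : ∀ {n} → Digraph n → ℕ → Set
BetaAtMost G k = Σ (PairSet _) λ X → IsFeedbackArcSet G X × card X ≤ k

-- γ(G): number of unordered pairs {u,v}, u ≠ v, with neither uv nor vu an edge
-- (each unordered pair counted once via toℕ u < toℕ v).
nonAdjPairs : ∀ {n} → Digraph n → PairSet n
nonAdjPairs G u v = (toℕ u <ᵇ toℕ v) ∧ (not (adj G u v) ∧ not (adj G v u))

gamma : ∀ {n} → Digraph n → ℕ
gamma G = card (nonAdjPairs G)

-- We rank the vertices of every vertex set S so that the back edges inside S (edges uw with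
-- rank w ≤ rank u) number at most γ S, the non-adjacent pairs of S; the back edges of any ranking
-- form a feedback arc set. Pick a centre v ∈ S and split S − v into its in-neighbours A and the
-- rest R, which contains the out-neighbours B of v. Ranking A recursively, then v, then R
-- recursively, the back edges are those inside A, those inside R and the edges from R to A, while
-- the non-adjacent pairs inside A, inside R and across A × B are distinct pairs of S. So it suffices
-- to find a centre with at most as many edges from R to A as non-adjacent pairs in A × B, and on
-- average over v there is one: an edge x → a from R to A is, for the centre a, the pair (x, v) of
-- an in- and an out-neighbour of a, and x, v are non-adjacent since x ∈ R and since v → x would
-- close the directed triangle x → a → v → x.

module Submission where

open import Defs
open import Algebra.Bundles using (CommutativeMonoid)
open import Data.Bool using (Bool; true; false; not; _∧_; if_then_else_; T)
open import Data.Bool.Properties using (T-∧; T-≡; ∧-comm; ∧-commutativeMonoid)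
open import Data.Empty using (⊥; ⊥-elim)
open import Data.Fin using (Fin; zero; suc; toℕ; inject₁; fromℕ)
open import Data.Fin.Properties using (toℕ-injective; _≟_; any?)
open import Data.List using (allFin; tabulate) renaming (map to mapList)
open import Data.List.Properties using (map-tabulate)
open import Data.Nat using (ℕ; zero; suc; _+_; _≤_; _<_; _≤ᵇ_; _<ᵇ_; z≤n; s≤s)
open import Data.Nat.ListAction as List using ()
open import Data.Nat.Properties
  using ( +-0-commutativeMonoid; +-comm; +-identityʳ; +-mono-≤; +-monoˡ-≤; +-monoʳ-≤; +-mono-<-≤; +-mono-≤-<
        ; +-cancelˡ-≤; +-cancelˡ-<; m≤m+n; m≤n+m; m<m+n; ≤-refl; ≤-reflexive; ≤-trans; ≤-antisym; ≤-pred
        ; <-irrefl; <-asym; <-trans; ≤-<-trans; <-≤-trans; <⇒≤; <⇒≱; ≮⇒≥; ≰⇒>; n≮0; _<?_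
        ; <ᵇ⇒<; <⇒<ᵇ; ≤ᵇ⇒≤; ≤⇒≤ᵇ; module ≤-Reasoning )
open import Data.Nat.Tactic.RingSolver using (solve-∀)
open import Data.Product using (Σ; ∃; _×_; _,_; proj₁; proj₂)
open import Data.Sum using (_⊎_; inj₁; inj₂)
open import Data.Unit using (tt)
open import Function using (_∘_)
open import Function.Bundles using (Equivalence)
open import Relation.Binary.PropositionalEquality
  using (_≡_; _≢_; refl; sym; trans; cong; subst; subst₂; module ≡-Reasoning)
open import Relation.Nullary using (¬_; yes; no)
open import Relation.Nullary.Decidable using (⌊_⌋; toWitness; fromWitness; T?)

open import Algebra.Properties.CommutativeMonoid.Sum +-0-commutativeMonoid
  using (sum-syntax; ∑-comm; ∑-distrib-+; sum-cong-≗; sum-replicate-zero)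
open import Algebra.Properties.CommutativeSemigroup
  (CommutativeMonoid.commutativeSemigroup ∧-commutativeMonoid)
  using () renaming (x∙yz≈y∙xz to ∧-swap)

private
  variable
    n : ℕ

-- Finite sums

∑-mono-≤ : {f g : Fin n → ℕ} → (∀ i → f i ≤ g i) → ∑[ i < n ] f i ≤ ∑[ i < n ] g i
∑-mono-≤ {zero}  f≤g = z≤n
∑-mono-≤ {suc n} f≤g = +-mono-≤ (f≤g zero) (∑-mono-≤ (λ i → f≤g (suc i)))

∑-mono-< : {f g : Fin n → ℕ} → (∀ i → f i ≤ g i) → ∀ j → f j < g j → ∑[ i < n ] f i < ∑[ i < n ] g i
∑-mono-< f≤g zero    fj<gj = +-mono-<-≤ fj<gj (∑-mono-≤ (λ i → f≤g (suc i)))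
∑-mono-< f≤g (suc j) fj<gj = +-mono-≤-< (f≤g zero) (∑-mono-< (λ i → f≤g (suc i)) j fj<gj)

≤-∑ : (f : Fin n → ℕ) (j : Fin n) → f j ≤ ∑[ i < n ] f i
≤-∑ f zero    = m≤m+n (f zero) _
≤-∑ f (suc j) = ≤-trans (≤-∑ (λ i → f (suc i)) j) (m≤n+m _ (f zero))

∑-<⇒∃< : (f g : Fin n → ℕ) → ∑[ i < n ] f i < ∑[ i < n ] g i → ∃ λ i → f i < g i
∑-<⇒∃< {suc n} f g ∑f<∑g with f zero <? g zero
... | yes f₀<g₀ = zero , f₀<g₀
... | no  f₀≮g₀ with ∑-<⇒∃< (λ i → f (suc i)) (λ i → g (suc i))
                        (+-cancelˡ-< (g zero) _ _ (≤-<-trans (+-monoˡ-≤ _ (≮⇒≥ f₀≮g₀)) ∑f<∑g))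
... | i , fi<gi = suc i , fi<gi

∑³-reverse : (f : Fin n → Fin n → Fin n → ℕ) →
             ∑[ i < n ] ∑[ j < n ] ∑[ k < n ] f i j k ≡ ∑[ k < n ] ∑[ j < n ] ∑[ i < n ] f i j k
∑³-reverse {n} f = begin
  ∑[ i < n ] ∑[ j < n ] ∑[ k < n ] f i j k  ≡⟨ sum-cong-≗ (λ i → ∑-comm (f i)) ⟩
  ∑[ i < n ] ∑[ k < n ] ∑[ j < n ] f i j k  ≡⟨ ∑-comm (λ i k → ∑[ j < n ] f i j k) ⟩
  ∑[ k < n ] ∑[ i < n ] ∑[ j < n ] f i j k  ≡⟨ sum-cong-≗ (λ k → ∑-comm (λ i j → f i j k)) ⟩
  ∑[ k < n ] ∑[ j < n ] ∑[ i < n ] f i j k  ∎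
  where open ≡-Reasoning

∧-intro : {a b : Bool} → T a → T b → T (a ∧ b)
∧-intro Ta Tb = Equivalence.from T-∧ (Ta , Tb)

∧-elim : {a b : Bool} → T (a ∧ b) → T a × T b
∧-elim = Equivalence.to T-∧

not-intro : {a : Bool} → ¬ T a → T (not a)
not-intro {false} _  = tt
not-intro {true}  ¬a = ¬a tt

not-elim : {a : Bool} → T (not a) → ¬ T a
not-elim {false} _ ()

𝟙 : Bool → ℕ
𝟙 b = if b then 1 else 0

𝟙-mono : {a b : Bool} → (T a → T b) → 𝟙 a ≤ 𝟙 b
𝟙-mono {false}         _   = z≤n
𝟙-mono {true}  {true}  _   = ≤-refl
𝟙-mono {true}  {false} a⇒b = ⊥-elim (a⇒b tt)

𝟙-cover₃ : {a b c d : Bool} → (T a → T b ⊎ T c ⊎ T d) → 𝟙 a ≤ 𝟙 b + 𝟙 c + 𝟙 d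
𝟙-cover₃ {false} _ = z≤n
𝟙-cover₃ {true} {b} {c} {d} cover with cover tt
... | inj₁ Tb        = ≤-trans (≤-trans (𝟙-mono (λ _ → Tb)) (m≤m+n (𝟙 b) (𝟙 c))) (m≤m+n _ (𝟙 d))
... | inj₂ (inj₁ Tc) = ≤-trans (≤-trans (𝟙-mono (λ _ → Tc)) (m≤n+m (𝟙 c) (𝟙 b))) (m≤m+n _ (𝟙 d))
... | inj₂ (inj₂ Td) = ≤-trans (𝟙-mono (λ _ → Td)) (m≤n+m (𝟙 d) (𝟙 b + 𝟙 c))

𝟙-partition : {a b c : Bool} → (T a → T c) → (T b → T c) → (T a → T b → ⊥) →
              ∀ x → 𝟙 (a ∧ x) + 𝟙 (b ∧ x) ≤ 𝟙 (c ∧ x)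
𝟙-partition {true}  {true}          _   _   a#b _ = ⊥-elim (a#b tt tt)
𝟙-partition {true}  {false} {true}  _   _   _   x = ≤-reflexive (+-identityʳ (𝟙 x))
𝟙-partition {true}  {false} {false} a⇒c _   _   _ = ⊥-elim (a⇒c tt)
𝟙-partition {false} {true}  {true}  _   _   _   _ = ≤-refl
𝟙-partition {false} {true}  {false} _   b⇒c _   _ = ⊥-elim (b⇒c tt)
𝟙-partition {false} {false}         _   _   _   _ = z≤n

-- Vertex sets and relations, counted

VertexSet : ℕ → Set
VertexSet n = Fin n → Bool

_⊆_ : VertexSet n → VertexSet n → Set
A ⊆ B = ∀ u → T (A u) → T (B u)

Disjoint : VertexSet n → VertexSet n → Set
Disjoint A B = ∀ u → T (A u) → T (B u) → ⊥

_⊆²_ : PairSet n → PairSet n → Set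
P ⊆² Q = ∀ u w → T (P u w) → T (Q u w)

infixr 6 _∩_
infix 7 _ᵀ

_∩_ : PairSet n → PairSet n → PairSet n
(P ∩ Q) u w = P u w ∧ Q u w

_ᵀ : PairSet n → PairSet n
(P ᵀ) u w = P w u

restrict : VertexSet n → VertexSet n → PairSet n → PairSet n
restrict A B P u w = A u ∧ (B w ∧ P u w)

lessThan : PairSet n
lessThan u w = toℕ u <ᵇ toℕ w

𝟙-split-< : {u w : Fin n} → u ≢ w → ∀ q → 𝟙 q ≡ 𝟙 (lessThan u w ∧ q) + 𝟙 (lessThan w u ∧ q)
𝟙-split-< {u = u} {w} u≢w q with lessThan u w in u<w | lessThan w u in w<u
... | true  | true  =
  ⊥-elim (<-asym (<ᵇ⇒< (toℕ u) (toℕ w) (subst T (sym u<w) tt)) (<ᵇ⇒< (toℕ w) (toℕ u) (subst T (sym w<u) tt)))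
... | true  | false = sym (+-identityʳ (𝟙 q))
... | false | true  = refl
... | false | false = ⊥-elim (u≢w (toℕ-injective (≤-antisym (≮⇒≥ w≮u) (≮⇒≥ u≮w))))
  where
  u≮w : ¬ toℕ u < toℕ w
  u≮w = subst T u<w ∘ <⇒<ᵇ
  w≮u : ¬ toℕ w < toℕ u
  w≮u = subst T w<u ∘ <⇒<ᵇ

size : VertexSet n → ℕ
size {n} S = ∑[ u < n ] 𝟙 (S u)

size-< : {A S : VertexSet n} → A ⊆ S → ∀ v → T (S v) → ¬ T (A v) → size A < size S
size-< A⊆S v v∈S v∉A = ∑-mono-< (λ u → 𝟙-mono (A⊆S u)) v (𝟙-< v∉A v∈S)
  where
  𝟙-< : {a b : Bool} → ¬ T a → T b → 𝟙 a < 𝟙 b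
  𝟙-< {false} {true} _ _ = s≤s z≤n
  𝟙-< {true}         ¬a _ = ⊥-elim (¬a tt)

size-pos : (S : VertexSet n) (u : Fin n) → T (S u) → 0 < size S
size-pos S u u∈S = <-≤-trans (s≤s z≤n) (≤-trans (𝟙-mono (λ _ → u∈S)) (≤-∑ (λ v → 𝟙 (S v)) u))

count : PairSet n → ℕ
count {n} P = ∑[ u < n ] ∑[ w < n ] 𝟙 (P u w)

sum-map-allFin : (f : Fin n → ℕ) → List.sum (mapList f (allFin n)) ≡ ∑[ i < n ] f i
sum-map-allFin {n} f = trans (cong List.sum (map-tabulate (λ i → i) f)) (sum-tabulate f)
  where
  sum-tabulate : ∀ {m} (g : Fin m → ℕ) → List.sum (tabulate g) ≡ ∑[ i < m ] g i
  sum-tabulate {zero}  g = refl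
  sum-tabulate {suc m} g = cong (g zero +_) (sum-tabulate (g ∘ suc))

card≡count : (P : PairSet n) → card P ≡ count P
card≡count {n} P = begin
  card P
    ≡⟨ sum-map-allFin (λ u → List.sum (mapList (λ w → 𝟙 (P u w)) (allFin n))) ⟩
  ∑[ u < n ] List.sum (mapList (λ w → 𝟙 (P u w)) (allFin n))
    ≡⟨ sum-cong-≗ (λ u → sum-map-allFin (λ w → 𝟙 (P u w))) ⟩
  count P ∎
  where open ≡-Reasoning

∑²-mono-≤ : {f g : Fin n → Fin n → ℕ} → (∀ u w → f u w ≤ g u w) →
            ∑[ u < n ] ∑[ w < n ] f u w ≤ ∑[ u < n ] ∑[ w < n ] g u w
∑²-mono-≤ f≤g = ∑-mono-≤ (λ u → ∑-mono-≤ (f≤g u))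

∑²-distrib-+ : (f g : Fin n → Fin n → ℕ) →
               ∑[ u < n ] ∑[ w < n ] (f u w + g u w)
                 ≡ ∑[ u < n ] ∑[ w < n ] f u w + ∑[ u < n ] ∑[ w < n ] g u w
∑²-distrib-+ {n} f g = begin
  ∑[ u < n ] ∑[ w < n ] (f u w + g u w)                    ≡⟨ sum-cong-≗ (λ u → ∑-distrib-+ (f u) (g u)) ⟩
  ∑[ u < n ] (∑[ w < n ] f u w + ∑[ w < n ] g u w)         ≡⟨ ∑-distrib-+ (λ u → ∑[ w < n ] f u w) _ ⟩
  ∑[ u < n ] ∑[ w < n ] f u w + ∑[ u < n ] ∑[ w < n ] g u w  ∎
  where open ≡-Reasoning

count-cong : {P Q : PairSet n} → (∀ u w → P u w ≡ Q u w) → count P ≡ count Q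
count-cong P≗Q = sum-cong-≗ (λ u → sum-cong-≗ (λ w → cong 𝟙 (P≗Q u w)))

count-empty : count {n} (λ _ _ → false) ≡ 0
count-empty {n} = begin
  ∑[ u < n ] ∑[ w < n ] 0  ≡⟨ sum-cong-≗ {n} (λ _ → sum-replicate-zero n) ⟩
  ∑[ u < n ] 0             ≡⟨ sum-replicate-zero n ⟩
  0                        ∎
  where open ≡-Reasoning

count-mono : {P Q : PairSet n} → P ⊆² Q → count P ≤ count Q
count-mono P⊆Q = ∑²-mono-≤ (λ u w → 𝟙-mono (P⊆Q u w))

count-cover₃ : {P Q₁ Q₂ Q₃ : PairSet n} →
               (∀ u w → T (P u w) → T (Q₁ u w) ⊎ T (Q₂ u w) ⊎ T (Q₃ u w)) →
               count P ≤ count Q₁ + count Q₂ + count Q₃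
count-cover₃ {P = P} {Q₁} {Q₂} {Q₃} cover = begin
  count P                                                  ≤⟨ ∑²-mono-≤ (λ u w → 𝟙-cover₃ (cover u w)) ⟩
  ∑[ u < _ ] ∑[ w < _ ] (𝟙 (Q₁ u w) + 𝟙 (Q₂ u w) + 𝟙 (Q₃ u w))
    ≡⟨ ∑²-distrib-+ (λ u w → 𝟙 (Q₁ u w) + 𝟙 (Q₂ u w)) (λ u w → 𝟙 (Q₃ u w)) ⟩
  ∑[ u < _ ] ∑[ w < _ ] (𝟙 (Q₁ u w) + 𝟙 (Q₂ u w)) + count Q₃
    ≡⟨ cong (_+ count Q₃) (∑²-distrib-+ (λ u w → 𝟙 (Q₁ u w)) (λ u w → 𝟙 (Q₂ u w))) ⟩
  count Q₁ + count Q₂ + count Q₃                           ∎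
  where open ≤-Reasoning

count-+-≤ : {P Q R : PairSet n} → (∀ u w → 𝟙 (P u w) + 𝟙 (Q u w) ≤ 𝟙 (R u w)) →
            count P + count Q ≤ count R
count-+-≤ {P = P} {Q} pointwise =
  ≤-trans (≤-reflexive (sym (∑²-distrib-+ (λ u w → 𝟙 (P u w)) (λ u w → 𝟙 (Q u w)))))
          (∑²-mono-≤ pointwise)

count-split-< : {A B : VertexSet n} → Disjoint A B → (Q : PairSet n) →
                count (restrict A B Q)
                  ≡ count (restrict A B (lessThan ∩ Q)) + count (restrict B A (lessThan ∩ Q ᵀ))
count-split-< {n} {A} {B} A#B Q = begin
  count (restrict A B Q)
    ≡⟨ sum-cong-≗ (λ u → sum-cong-≗ (split u)) ⟩
  ∑[ u < n ] ∑[ w < n ] (𝟙 (restrict A B (lessThan ∩ Q) u w) + 𝟙 (restrict A B (lessThan ᵀ ∩ Q) u w))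
    ≡⟨ ∑²-distrib-+ (λ u w → 𝟙 (restrict A B (lessThan ∩ Q) u w)) _ ⟩
  count (restrict A B (lessThan ∩ Q)) + count (restrict A B (lessThan ᵀ ∩ Q))
    ≡⟨ cong (count (restrict A B (lessThan ∩ Q)) +_)
            (∑-comm (λ u w → 𝟙 (restrict A B (lessThan ᵀ ∩ Q) u w))) ⟩
  count (restrict A B (lessThan ∩ Q)) + ∑[ w < n ] ∑[ u < n ] 𝟙 (restrict A B (lessThan ᵀ ∩ Q) u w)
    ≡⟨ cong (count (restrict A B (lessThan ∩ Q)) +_)
            (sum-cong-≗ (λ w → sum-cong-≗ (λ u → cong 𝟙 (∧-swap (A u) (B w) _)))) ⟩
  count (restrict A B (lessThan ∩ Q)) + count (restrict B A (lessThan ∩ Q ᵀ))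
    ∎
  where
  open ≡-Reasoning
  split : ∀ u w → 𝟙 (restrict A B Q u w)
                    ≡ 𝟙 (restrict A B (lessThan ∩ Q) u w) + 𝟙 (restrict A B (lessThan ᵀ ∩ Q) u w)
  split u w with A u in Au | B w in Bw
  ... | false | _     = refl
  ... | true  | false = refl
  ... | true  | true  = 𝟙-split-< u≢w (Q u w)
    where
    u≢w : u ≢ w
    u≢w refl = A#B u (Equivalence.from T-≡ Au) (Equivalence.from T-≡ Bw)

restrict-monoʳ : (A : VertexSet n) {B B′ : VertexSet n} → B ⊆ B′ → (P : PairSet n) →
                 restrict A B P ⊆² restrict A B′ P
restrict-monoʳ A B⊆B′ P u w p with A u
... | true = ∧-intro (B⊆B′ w (proj₁ (∧-elim p))) (proj₂ (∧-elim p))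

module _ {A R S : VertexSet n} (A⊆S : A ⊆ S) (R⊆S : R ⊆ S) (A#R : Disjoint A R) where

  count-partitionˡ : (C : VertexSet n) (P : PairSet n) →
                     count (restrict A C P) + count (restrict R C P) ≤ count (restrict S C P)
  count-partitionˡ C P = count-+-≤ (λ u w → 𝟙-partition (A⊆S u) (R⊆S u) (A#R u) (C w ∧ P u w))

  count-partitionʳ : (C : VertexSet n) (P : PairSet n) →
                     count (restrict C A P) + count (restrict C R P) ≤ count (restrict C S P)
  count-partitionʳ C P = count-+-≤ pointwise
    where
    pointwise : ∀ u w → 𝟙 (restrict C A P u w) + 𝟙 (restrict C R P u w) ≤ 𝟙 (restrict C S P u w)
    pointwise u w with C u
    ... | true  = 𝟙-partition (A⊆S w) (R⊆S w) (A#R w) (P u w)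
    ... | false = z≤n

  count-quadrants : (P : PairSet n) →
                    count (restrict A A P) + count (restrict A R P)
                      + (count (restrict R A P) + count (restrict R R P))
                      ≤ count (restrict S S P)
  count-quadrants P = ≤-trans (+-mono-≤ (count-partitionʳ A P) (count-partitionʳ R P)) (count-partitionˡ S P)

-- Rankings and digraphs

increasing⇒≤ : ∀ {m} (g : Fin (suc m) → ℕ) → (∀ i → g (inject₁ i) < g (suc i)) → ∀ j → g zero ≤ g j
increasing⇒≤         g _    zero    = ≤-refl
increasing⇒≤ {suc m} g g↑ (suc j) = ≤-trans (<⇒≤ (g↑ zero)) (increasing⇒≤ (g ∘ suc) (g↑ ∘ suc) j)

ranked⇒acyclic : (R : PairSet n) (r : Fin n → ℕ) → (∀ {u w} → R u w ≡ true → r u < r w) → AcyclicRel R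
ranked⇒acyclic R r R↑ m cycle =
  <-irrefl refl (≤-<-trans (increasing⇒≤ (r ∘ vert) (R↑ ∘ step) (fromℕ m)) (R↑ close))
  where open DirCycle cycle

descending : (Fin n → ℕ) → PairSet n
descending r u w = r w ≤ᵇ r u

backEdges-feedbackArcSet : (G : Digraph n) (r : Fin n → ℕ) → IsFeedbackArcSet G (adj G ∩ descending r)
backEdges-feedbackArcSet G r = ⊆-edges , ranked⇒acyclic (deleteEdges G (adj G ∩ descending r)) r kept↑
  where
  ⊆-edges : SubsetOfEdges (adj G ∩ descending r) G
  ⊆-edges u w e with adj G u w
  ... | true = refl
  kept↑ : ∀ {u w} → deleteEdges G (adj G ∩ descending r) u w ≡ true → r u < r w
  kept↑ {u} {w} e with adj G u w | descending r u w in w≤ᵇu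
  ... | true | false = ≰⇒> (subst T w≤ᵇu ∘ ≤⇒≤ᵇ)

module _ (G : Digraph n) where

  private
    E : PairSet n
    E = adj G

  no-loop : ∀ {u} → ¬ T (E u u)
  no-loop {u} = subst T (loopless G u)

  edge⇒≢ : ∀ {u w} → T (E u w) → u ≢ w
  edge⇒≢ uw refl = no-loop uw

  nonAdjacent : PairSet n
  nonAdjacent u w = not (E u w) ∧ not (E w u)

  γ : VertexSet n → ℕ
  γ S = count (restrict S S (nonAdjPairs G))

  GoodRanking : VertexSet n → Set
  GoodRanking S = Σ (Fin n → ℕ) λ r → count (restrict S S (E ∩ descending r)) ≤ γ S

  backEdge-intro : ∀ {S : VertexSet n} {r u w} → T (S u) → T (S w) → T (E u w) → r w ≤ r u →
                   T (restrict S S (E ∩ descending r) u w)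
  backEdge-intro u∈S w∈S uw w≤u = ∧-intro u∈S (∧-intro w∈S (∧-intro uw (≤⇒≤ᵇ w≤u)))

  backEdge-elim : ∀ {S : VertexSet n} {r u w} → T (restrict S S (E ∩ descending r) u w) →
                  T (S u) × T (S w) × T (E u w) × r w ≤ r u
  backEdge-elim {r = r} {u} {w} b with ∧-elim b
  ... | u∈S , b′ with ∧-elim b′
  ... | w∈S , b″ with ∧-elim b″
  ... | uw , w≤u = u∈S , w∈S , uw , ≤ᵇ⇒≤ (r w) (r u) w≤u

  module _ (three-free : ThreeFree G) where

    no-digon : ∀ {u w} → T (E u w) → T (E w u) → ⊥
    no-digon {u} {w} uw wu = three-free 1 (s≤s (s≤s z≤n)) record
      { vert = vert ; inj = inj ; step = λ { zero → Equivalence.to T-≡ uw } ; close = Equivalence.to T-≡ wu }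
      where
      vert : Fin 2 → Fin n
      vert zero       = u
      vert (suc zero) = w
      inj : ∀ {i j} → vert i ≡ vert j → i ≡ j
      inj {zero}     {zero}     _   = refl
      inj {zero}     {suc zero} u≡w = ⊥-elim (edge⇒≢ uw u≡w)
      inj {suc zero} {zero}     w≡u = ⊥-elim (edge⇒≢ wu w≡u)
      inj {suc zero} {suc zero} _   = refl

    no-triangle : ∀ {u v w} → T (E u v) → T (E v w) → T (E w u) → ⊥
    no-triangle {u} {v} {w} uv vw wu = three-free 2 (s≤s (s≤s (s≤s z≤n))) record
      { vert = vert ; inj = inj ; step = step ; close = Equivalence.to T-≡ wu }
      where
      vert : Fin 3 → Fin n
      vert zero             = u
      vert (suc zero)       = v
      vert (suc (suc zero)) = w
      step : ∀ i → E (vert (inject₁ i)) (vert (suc i)) ≡ true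
      step zero       = Equivalence.to T-≡ uv
      step (suc zero) = Equivalence.to T-≡ vw
      inj : ∀ {i j} → vert i ≡ vert j → i ≡ j
      inj {zero}             {zero}             _   = refl
      inj {zero}             {suc zero}         u≡v = ⊥-elim (edge⇒≢ uv u≡v)
      inj {zero}             {suc (suc zero)}   u≡w = ⊥-elim (edge⇒≢ wu (sym u≡w))
      inj {suc zero}         {zero}             v≡u = ⊥-elim (edge⇒≢ uv (sym v≡u))
      inj {suc zero}         {suc zero}         _   = refl
      inj {suc zero}         {suc (suc zero)}   v≡w = ⊥-elim (edge⇒≢ vw v≡w)
      inj {suc (suc zero)}   {zero}             w≡u = ⊥-elim (edge⇒≢ wu w≡u)
      inj {suc (suc zero)}   {suc zero}         w≡v = ⊥-elim (edge⇒≢ vw (sym w≡v))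
      inj {suc (suc zero)}   {suc (suc zero)}   _   = refl

    module Split (S : VertexSet n) (v : Fin n) where

      inNbrs outNbrs rest : VertexSet n
      inNbrs  u = S u ∧ E u v
      outNbrs u = S u ∧ E v u
      rest    u = S u ∧ (not (E u v) ∧ not ⌊ u ≟ v ⌋)

      crossEdges : PairSet n
      crossEdges = restrict rest inNbrs E

      openPaths : PairSet n
      openPaths = restrict inNbrs outNbrs nonAdjacent

      rest-intro : ∀ {u} → T (S u) → ¬ T (E u v) → u ≢ v → T (rest u)
      rest-intro u∈S ¬uv u≢v = ∧-intro u∈S (∧-intro (not-intro ¬uv) (not-intro (u≢v ∘ toWitness)))

      rest-elim : ∀ u → T (rest u) → T (S u) × ¬ T (E u v) × u ≢ v
      rest-elim u r with ∧-elim r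
      ... | u∈S , r′ with ∧-elim r′
      ... | ¬uv , u≢v = u∈S , not-elim ¬uv , λ u≡v → not-elim u≢v (fromWitness {a? = u ≟ v} u≡v)

      inNbrs⊆S : inNbrs ⊆ S
      inNbrs⊆S _ = proj₁ ∘ ∧-elim

      rest⊆S : rest ⊆ S
      rest⊆S u = proj₁ ∘ rest-elim u

      inNbrs#rest : Disjoint inNbrs rest
      inNbrs#rest u a r = proj₁ (proj₂ (rest-elim u r)) (proj₂ (∧-elim a))

      outNbrs⊆rest : outNbrs ⊆ rest
      outNbrs⊆rest _ b with ∧-elim b
      ... | u∈S , vu = rest-intro u∈S (no-digon vu) (edge⇒≢ vu ∘ sym)

      v∉inNbrs : ¬ T (inNbrs v)
      v∉inNbrs = no-loop ∘ proj₂ ∘ ∧-elim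

      v∉rest : ¬ T (rest v)
      v∉rest r = proj₂ (proj₂ (rest-elim v r)) refl

      data Position (u : Fin n) : Set where
        inNbr  : T (inNbrs u) → Position u
        centre : u ≡ v → Position u
        other  : T (rest u) → Position u

      position : ∀ u → T (S u) → Position u
      position u u∈S with E u v in uv | u ≟ v
      ... | true  | _         = inNbr (∧-intro u∈S (subst T (sym uv) tt))
      ... | false | yes u≡v   = centre u≡v
      ... | false | no  u≢v   = other (rest-intro u∈S (subst T uv) u≢v)

      nonAdjacent-sym : ∀ u w → nonAdjacent u w ≡ nonAdjacent w u
      nonAdjacent-sym u w = ∧-comm (not (E u w)) (not (E w u))

      γ-split : γ inNbrs + γ rest + count openPaths ≤ γ S
      γ-split = begin
        γ inNbrs + γ rest + count openPaths
          ≤⟨ +-monoʳ-≤ (γ inNbrs + γ rest) openPaths≤ ⟩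
        γ inNbrs + γ rest + (γ⟨ inNbrs , rest ⟩ + γ⟨ rest , inNbrs ⟩)
          ≡⟨ interchange (γ inNbrs) (γ rest) _ _ ⟩
        γ inNbrs + γ⟨ inNbrs , rest ⟩ + (γ⟨ rest , inNbrs ⟩ + γ rest)
          ≤⟨ count-quadrants inNbrs⊆S rest⊆S inNbrs#rest (nonAdjPairs G) ⟩
        γ S ∎
        where
        open ≤-Reasoning
        interchange : ∀ a b c d → a + b + (c + d) ≡ a + c + (d + b)
        interchange = solve-∀
        γ⟨_,_⟩ : VertexSet n → VertexSet n → ℕ
        γ⟨ A , B ⟩ = count (restrict A B (nonAdjPairs G))
        openPaths≤ : count openPaths ≤ γ⟨ inNbrs , rest ⟩ + γ⟨ rest , inNbrs ⟩
        openPaths≤ = begin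
          count openPaths
            ≤⟨ count-mono (restrict-monoʳ inNbrs outNbrs⊆rest nonAdjacent) ⟩
          count (restrict inNbrs rest nonAdjacent)
            ≡⟨ count-split-< inNbrs#rest nonAdjacent ⟩
          γ⟨ inNbrs , rest ⟩ + count (restrict rest inNbrs (lessThan ∩ nonAdjacent ᵀ))
            ≡⟨ cong (γ⟨ inNbrs , rest ⟩ +_) (count-cong (λ u w →
                 cong (λ x → rest u ∧ (inNbrs w ∧ (lessThan u w ∧ x))) (nonAdjacent-sym w u))) ⟩
          γ⟨ inNbrs , rest ⟩ + γ⟨ rest , inNbrs ⟩ ∎

      module Extend (rA rR : Fin n → ℕ) where

        K : ℕ
        K = ∑[ u < n ] rA u

        rank : Fin n → ℕ
        rank u = if inNbrs u then rA u else if rest u then 2 + K + rR u else suc K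

        rank-inNbrs : ∀ {u} → T (inNbrs u) → rank u ≡ rA u
        rank-inNbrs {u} a with inNbrs u
        ... | true = refl

        rank-rest : ∀ {u} → T (rest u) → rank u ≡ 2 + K + rR u
        rank-rest {u} r with inNbrs u in a
        ... | true  = ⊥-elim (inNbrs#rest u (Equivalence.from T-≡ a) r)
        ... | false with rest u
        ...   | true = refl

        rank-centre : rank v ≡ suc K
        rank-centre with inNbrs v in a | rest v in r
        ... | true  | _     = ⊥-elim (v∉inNbrs (Equivalence.from T-≡ a))
        ... | false | true  = ⊥-elim (v∉rest (Equivalence.from T-≡ r))
        ... | false | false = refl

        inNbrs<centre : ∀ {u} → T (inNbrs u) → rank u < rank v
        inNbrs<centre {u} a rewrite rank-inNbrs a | rank-centre = s≤s (≤-∑ rA u)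

        centre<rest : ∀ {u} → T (rest u) → rank v < rank u
        centre<rest {u} r rewrite rank-rest r | rank-centre = s≤s (s≤s (m≤m+n K (rR u)))

        backEdge-cover : ∀ u w → T (restrict S S (E ∩ descending rank) u w) →
                         T (restrict inNbrs inNbrs (E ∩ descending rA) u w) ⊎
                         T (restrict rest rest (E ∩ descending rR) u w) ⊎
                         T (crossEdges u w)
        backEdge-cover u w b with backEdge-elim b
        ... | u∈S , w∈S , uw , w≤u with position u u∈S | position w w∈S
        ... | inNbr a     | inNbr a′    =
          inj₁ (backEdge-intro a a′ uw (subst₂ _≤_ (rank-inNbrs a′) (rank-inNbrs a) w≤u))
        ... | inNbr a     | centre refl = ⊥-elim (<⇒≱ (inNbrs<centre a) w≤u)
        ... | inNbr a     | other r′    = ⊥-elim (<⇒≱ (<-trans (inNbrs<centre a) (centre<rest r′)) w≤u)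
        ... | centre refl | inNbr a′    = ⊥-elim (no-digon uw (proj₂ (∧-elim a′)))
        ... | centre refl | centre refl = ⊥-elim (no-loop uw)
        ... | centre refl | other r′    = ⊥-elim (<⇒≱ (centre<rest r′) w≤u)
        ... | other r     | inNbr a′    = inj₂ (inj₂ (∧-intro r (∧-intro a′ uw)))
        ... | other r     | centre refl = ⊥-elim (proj₁ (proj₂ (rest-elim u r)) uw)
        ... | other r     | other r′    =
          inj₂ (inj₁ (backEdge-intro r r′ uw
            (+-cancelˡ-≤ (2 + K) _ _ (subst₂ _≤_ (rank-rest r′) (rank-rest r) w≤u))))

      extend : GoodRanking inNbrs → GoodRanking rest → count crossEdges ≤ count openPaths →
               GoodRanking S
      extend (rA , boundA) (rR , boundR) cross≤open = rank , (begin
        count (restrict S S (E ∩ descending rank))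
          ≤⟨ count-cover₃ backEdge-cover ⟩
        count (restrict inNbrs inNbrs (E ∩ descending rA)) + count (restrict rest rest (E ∩ descending rR))
          + count crossEdges
          ≤⟨ +-mono-≤ (+-mono-≤ boundA boundR) cross≤open ⟩
        γ inNbrs + γ rest + count openPaths
          ≤⟨ γ-split ⟩
        γ S ∎)
        where
        open Extend rA rR
        open ≤-Reasoning

    open Split

    crossEdge⇒openPath : ∀ S v x a → T (S v ∧ crossEdges S v x a) → T (S a ∧ openPaths S a x v)
    crossEdge⇒openPath S v x a c with ∧-elim {S v} c
    ... | v∈S , c′ with ∧-elim {rest S v x} c′
    ... | x∈rest , c″ with ∧-elim {inNbrs S v a} c″
    ... | a∈in , xa with rest-elim S v x x∈rest | ∧-elim {S a} a∈in
    ... | x∈S , ¬xv , _ | a∈S , av =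
      ∧-intro a∈S (∧-intro (∧-intro x∈S xa) (∧-intro (∧-intro v∈S av)
        (∧-intro (not-intro ¬xv) (not-intro (no-triangle xa av)))))

    ∑-crossEdges≤∑-openPaths : ∀ S → ∑[ v < n ] count (λ x a → S v ∧ crossEdges S v x a)
                                   ≤ ∑[ v < n ] count (λ x a → S v ∧ openPaths S v x a)
    ∑-crossEdges≤∑-openPaths S = begin
      ∑[ v < n ] ∑[ x < n ] ∑[ a < n ] 𝟙 (S v ∧ crossEdges S v x a)
        ≤⟨ ∑-mono-≤ (λ v → ∑²-mono-≤ (λ x a → 𝟙-mono (crossEdge⇒openPath S v x a))) ⟩
      ∑[ v < n ] ∑[ x < n ] ∑[ a < n ] 𝟙 (S a ∧ openPaths S a x v)
        ≡⟨ ∑³-reverse (λ v x a → 𝟙 (S a ∧ openPaths S a x v)) ⟩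
      ∑[ a < n ] ∑[ x < n ] ∑[ v < n ] 𝟙 (S a ∧ openPaths S a x v) ∎
      where open ≤-Reasoning

    -- The summand 𝟙 (S v) makes the averaging strict and forces the centre it yields into S.
    good-centre : ∀ S u₀ → T (S u₀) → ∃ λ v → T (S v) × count (crossEdges S v) ≤ count (openPaths S v)
    good-centre S u₀ u₀∈S with ∑-<⇒∃< (λ v → count (λ x a → S v ∧ crossEdges S v x a))
                                    (λ v → count (λ x a → S v ∧ openPaths S v x a) + 𝟙 (S v)) averages
      where
      averages : ∑[ v < n ] count (λ x a → S v ∧ crossEdges S v x a)
                   < ∑[ v < n ] (count (λ x a → S v ∧ openPaths S v x a) + 𝟙 (S v))
      averages = begin-strict
        ∑[ v < n ] count (λ x a → S v ∧ crossEdges S v x a)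
          ≤⟨ ∑-crossEdges≤∑-openPaths S ⟩
        ∑[ v < n ] count (λ x a → S v ∧ openPaths S v x a)
          <⟨ m<m+n _ (size-pos S u₀ u₀∈S) ⟩
        ∑[ v < n ] count (λ x a → S v ∧ openPaths S v x a) + size S
          ≡⟨ ∑-distrib-+ (λ v → count (λ x a → S v ∧ openPaths S v x a)) (λ v → 𝟙 (S v)) ⟨
        ∑[ v < n ] (count (λ x a → S v ∧ openPaths S v x a) + 𝟙 (S v)) ∎
        where open ≤-Reasoning
    ... | v , cross<open+1 = v , at-centre cross<open+1
      where
      at-centre : count (λ x a → S v ∧ crossEdges S v x a) < count (λ x a → S v ∧ openPaths S v x a) + 𝟙 (S v) →
                  T (S v) × count (crossEdges S v) ≤ count (openPaths S v)
      at-centre lt with S v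
      ... | true  = tt , ≤-pred (subst (count (crossEdges S v) <_) (+-comm (count (openPaths S v)) 1) lt)
      ... | false = ⊥-elim (<-irrefl (sym (+-identityʳ _)) lt)

    emptyRanking : ∀ S → (∀ u → ¬ T (S u)) → GoodRanking S
    emptyRanking S ∅ =
      (λ _ → 0) , ≤-trans (count-mono nothing) (≤-trans (≤-reflexive (count-empty {n})) z≤n)
      where
      nothing : restrict S S (E ∩ descending (λ _ → 0)) ⊆² (λ _ _ → false)
      nothing u w b = ∅ u (proj₁ (∧-elim b))

    goodRanking : ∀ k S → size S ≤ k → GoodRanking S
    goodRanking zero    S size≤0 = emptyRanking S (λ u u∈S → n≮0 (<-≤-trans (size-pos S u u∈S) size≤0))
    goodRanking (suc k) S size≤k with any? (λ u → T? (S u))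
    ... | no  ∄u∈S       = emptyRanking S (λ u u∈S → ∄u∈S (u , u∈S))
    ... | yes (u₀ , u₀∈S) with good-centre S u₀ u₀∈S
    ... | v , v∈S , cross≤open =
      extend S v (goodRanking k (inNbrs S v) (smaller (inNbrs⊆S S v) (v∉inNbrs S v)))
                 (goodRanking k (rest S v) (smaller (rest⊆S S v) (v∉rest S v)))
                 cross≤open
      where
      smaller : ∀ {A} → A ⊆ S → ¬ T (A v) → size A ≤ k
      smaller A⊆S v∉A = ≤-pred (<-≤-trans (size-< A⊆S v v∈S v∉A) size≤k)

mainTheorem1 : ∀ (n : ℕ) (G : Digraph n) → ThreeFree G → BetaAtMost G (gamma G)
mainTheorem1 n G three-free with goodRanking G three-free (size {n} (λ _ → true)) (λ _ → true) ≤-refl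
... | r , bound = adj G ∩ descending r , backEdges-feedbackArcSet G r ,
                  subst₂ _≤_ (sym (card≡count (adj G ∩ descending r))) (sym (card≡count (nonAdjPairs G)))
                             bound
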